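{- Let $K\subseteq L$ be real closed fields and $C$ an additive cut in $L$. Let $C'$ and $C'_{\mathrm{mlt}}$ be the cuts induced on $K$ by $C$ and by $C_{\mathrm{mlt}}$ respectively (where $C_{\mathrm{mlt}}$ is computed in $L$). Suppose that $C'_{\mathrm{mlt}}=(C')_{\mathrm{mlt}}$ (the latter computed in $K$), and that $x,y\in L$ are two realizations of the cut $C'$ with $x\in C^-$ and $y\in C^+$. Then $y/x$ induces the cut $C'_{\mathrm{mlt}}$ on $K$.
   Context: For an ordered field $F$, a cut is a pair $D=(D^-,D^+)$ with $F=D^-\cup D^+$ disjoint and $D^-<D^+$. If $K\subseteq L$ and $D$ is a cut of $L$, the cut induced on $K$ is $(D^-\cap K,D^+\cap K)$; an element $a\in L$ induces on $K$ the cut $(\{c\in K:c<a\},\{c\in K:c\ge a\})$ and realizes a cut $E$ of $K$ if $E^-<a<E^+$. $D$ is additive if $D^-$ is closed under addition and contains a positive element. $D_{\mathrm{mlt}}$ is the cut of $F$ with left side $\{r\in F: r\cdot(D^-\cap F_+)\subseteq D^-\}$, where $F_+=\{c\in F:c>0\}$. -}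

module Defs where

open import Level using (Level; _⊔_; suc)
open import Data.Product using (Σ; _×_; _,_; ∃)
open import Data.Sum using (_⊎_)
open import Data.List using (List; []; _∷_)
open import Data.Nat using (ℕ)
open import Relation.Nullary using (¬_)
open import Relation.Binary.PropositionalEquality using (_≡_)

-- Ordered fields (carrier with propositional equality).
-- Inverse is total with the convention 0⁻¹ = 0 (only x ⁻¹ for x ≠ 0
-- is constrained).

record OrderedField (ℓ : Level) : Set (suc ℓ) where
  infixl 6 _+_
  infixl 7 _*_
  infix 4 _<_ _≤_
  field
    Carrier : Set ℓ
    0# 1#   : Carrier
    _+_ _*_ : Carrier → Carrier → Carrier
    -_      : Carrier → Carrier
    _⁻¹     : Carrier → Carrier
    _<_     : Carrier → Carrier → Set ℓ
    +-assoc : ∀ a b c → (a + b) + c ≡ a + (b + c)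
    +-comm  : ∀ a b → a + b ≡ b + a
    +-identityˡ : ∀ a → 0# + a ≡ a
    -‿inverseˡ  : ∀ a → (- a) + a ≡ 0#
    *-assoc : ∀ a b c → (a * b) * c ≡ a * (b * c)
    *-comm  : ∀ a b → a * b ≡ b * a
    *-identityˡ : ∀ a → 1# * a ≡ a
    distribˡ : ∀ a b c → a * (b + c) ≡ (a * b) + (a * c)
    0≢1 : ¬ (0# ≡ 1#)
    ⁻¹-inverseʳ : ∀ a → ¬ (a ≡ 0#) → a * (a ⁻¹) ≡ 1#
    <-irrefl : ∀ a → ¬ (a < a)
    <-trans  : ∀ {a b c} → a < b → b < c → a < c
    <-trichotomy : ∀ a b → a < b ⊎ (a ≡ b ⊎ b < a)
    +-mono-< : ∀ {a b} c → a < b → a + c < b + c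
    *-pos    : ∀ {a b} → 0# < a → 0# < b → 0# < a * b

  _≤_ : Carrier → Carrier → Set ℓ
  a ≤ b = a < b ⊎ a ≡ b

  _/_ : Carrier → Carrier → Carrier
  a / b = a * (b ⁻¹)

  _^_ : Carrier → ℕ → Carrier
  x ^ ℕ.zero = 1#
  x ^ ℕ.suc n = x * (x ^ n)

  eval : List Carrier → Carrier → Carrier
  eval [] x = 0#
  eval (c ∷ cs) x = c + x * eval cs x

  len : List Carrier → ℕ
  len [] = 0
  len (_ ∷ cs) = ℕ.suc (len cs)

  -- the monic polynomial  x^(len cs) + Σ cs_i x^i
  evalMonic : List Carrier → Carrier → Carrier
  evalMonic cs x = (x ^ len cs) + eval cs x



data Odd : ℕ → Set where
  odd-one : Odd 1
  odd-ss  : ∀ {n} → Odd n → Odd (ℕ.suc (ℕ.suc n))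

data AllIn {ℓ k : Level} {A : Set ℓ} (P : A → Set k) : List A → Set (ℓ ⊔ k) where
  []  : AllIn P []
  _∷_ : ∀ {c cs} → P c → AllIn P cs → AllIn P (c ∷ cs)

-- Real closed fields: every positive element is a square, and every
-- (w.l.o.g. monic) polynomial of odd degree has a root.

module _ {ℓ : Level} (F : OrderedField ℓ) where
  open OrderedField F

  IsRealClosed : Set ℓ
  IsRealClosed =
    (∀ a → 0# < a → Σ Carrier λ r → r * r ≡ a) ×
    (∀ (cs : List Carrier) → Odd (len cs) → Σ Carrier λ r → evalMonic cs r ≡ 0#)

  -- A subfield K ⊆ F (given as a predicate on F), with induced order,
  -- which is itself real closed.
  record IsRealClosedSubfield {k : Level} (K : Carrier → Set k) : Set (ℓ ⊔ k) where
    field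
      0∈ : K 0#
      1∈ : K 1#
      +∈ : ∀ {a b} → K a → K b → K (a + b)
      *∈ : ∀ {a b} → K a → K b → K (a * b)
      -∈ : ∀ {a} → K a → K (- a)
      ⁻¹∈ : ∀ {a} → K a → K (a ⁻¹)
      sqrt∈ : ∀ a → K a → 0# < a → Σ Carrier λ r → K r × (r * r ≡ a)
      oddRoot∈ : ∀ (cs : List Carrier) → AllIn K cs → Odd (len cs) →
                 Σ Carrier λ r → K r × (evalMonic cs r ≡ 0#)

  record Cut (c : Level) : Set (ℓ ⊔ suc c) where
    field
      Lo Hi : Carrier → Set c
      cover    : ∀ a → Lo a ⊎ Hi a
      disjoint : ∀ a → ¬ (Lo a × Hi a)
      ordered  : ∀ {a b} → Lo a → Hi b → a < b

  Additive : {c : Level} → Cut c → Set (ℓ ⊔ c)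
  Additive C = (∀ a b → Lo a → Lo b → Lo (a + b)) × (Σ Carrier λ p → (0# < p) × Lo p)
    where open Cut C

  -- left side of C_mlt (computed in F); the right side is its complement
  LoMlt : {c : Level} → Cut c → Carrier → Set (ℓ ⊔ c)
  LoMlt C r = ∀ d → Lo d → 0# < d → Lo (r * d)
    where open Cut C

  -- left side of (C')_mlt computed in the subfield K, where C' is the
  -- cut induced by C on K (so C'⁻ = C⁻ ∩ K); right side is the complement in K
  LoMltIn : {k c : Level} → (Carrier → Set k) → Cut c → Carrier → Set (ℓ ⊔ k ⊔ c)
  LoMltIn K C r = ∀ d → K d → Lo d → 0# < d → Lo (r * d)
    where open Cut C

  RealizesIn : {k c : Level} → (Carrier → Set k) → Cut c → Carrier → Set (ℓ ⊔ k ⊔ c)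
  RealizesIn K C a = (∀ e → K e → Lo e → e < a) × (∀ e → K e → Hi e → a < e)
    where open Cut C

  InducesOn : {k p : Level} → (Carrier → Set k) → Carrier → (Carrier → Set p) → Set (ℓ ⊔ k ⊔ p)
  InducesOn K a P =
    ∀ e → K e → ((e < a → P e) × (P e → e < a)) ×
                ((a ≤ e → ¬ P e) × (¬ P e → a ≤ e))

-- Write a = y / x with x > 0.  If e ∈ C_mlt then e·x ∈ C⁻ lies below y ∈ C⁺, so e < a.
-- Conversely let e ∈ K with 0 < e < a and d ∈ K ∩ C⁻ positive: since x realizes C' we
-- have d < x, hence e·d < e·x < y, and since y realizes C' the element e·d ∈ K cannot
-- lie in C⁺.  So e ∈ (C')_mlt, which by hypothesis means e ∈ C_mlt.
module Submission where

open import Defs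
open import Level using (Level)
open import Data.Product using (_×_; _,_; proj₁; proj₂)
open import Data.Sum using (inj₁; inj₂)
open import Data.Empty using (⊥-elim)
open import Relation.Nullary using (¬_)
open import Relation.Binary.PropositionalEquality

module OrderedFieldProperties {ℓ : Level} (F : OrderedField ℓ) where
  open OrderedField F
  open ≡-Reasoning

  +-identityʳ : ∀ a → a + 0# ≡ a
  +-identityʳ a = trans (+-comm a 0#) (+-identityˡ a)

  -‿inverseʳ : ∀ a → a + (- a) ≡ 0#
  -‿inverseʳ a = trans (+-comm a (- a)) (-‿inverseˡ a)

  x≡x+x⇒x≡0 : ∀ x → x ≡ x + x → x ≡ 0#
  x≡x+x⇒x≡0 x x≡x+x = sym (begin
    0#              ≡⟨ sym (-‿inverseˡ x) ⟩
    (- x) + x       ≡⟨ cong ((- x) +_) x≡x+x ⟩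
    (- x) + (x + x) ≡⟨ sym (+-assoc (- x) x x) ⟩
    ((- x) + x) + x ≡⟨ cong (_+ x) (-‿inverseˡ x) ⟩
    0# + x          ≡⟨ +-identityˡ x ⟩
    x               ∎)

  *-zeroʳ : ∀ a → a * 0# ≡ 0#
  *-zeroʳ a = x≡x+x⇒x≡0 (a * 0#)
    (trans (cong (a *_) (sym (+-identityˡ 0#))) (distribˡ a 0# 0#))

  *-zeroˡ : ∀ a → 0# * a ≡ 0#
  *-zeroˡ a = trans (*-comm 0# a) (*-zeroʳ a)

  *-distribʳ-+ : ∀ a b c → (a + b) * c ≡ a * c + b * c
  *-distribʳ-+ a b c = begin
    (a + b) * c   ≡⟨ *-comm (a + b) c ⟩
    c * (a + b)   ≡⟨ distribˡ c a b ⟩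
    c * a + c * b ≡⟨ cong₂ _+_ (*-comm c a) (*-comm c b) ⟩
    a * c + b * c ∎

  <⇒0<- : ∀ {a b} → a < b → 0# < b + (- a)
  <⇒0<- {a} {b} a<b = subst (_< b + (- a)) (-‿inverseʳ a) (+-mono-< (- a) a<b)

  -- b·c = (b − a)·c + a·c, and the first summand is positive.
  *-monoˡ-<-pos : ∀ {a b c} → 0# < c → a < b → a * c < b * c
  *-monoˡ-<-pos {a} {b} {c} 0<c a<b =
    subst₂ _<_ (+-identityˡ (a * c)) split (+-mono-< (a * c) (*-pos (<⇒0<- a<b) 0<c))
    where
    split : (b + (- a)) * c + a * c ≡ b * c
    split = begin
      (b + (- a)) * c + a * c     ≡⟨ cong (_+ a * c) (*-distribʳ-+ b (- a) c) ⟩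
      (b * c + (- a) * c) + a * c ≡⟨ +-assoc (b * c) _ _ ⟩
      b * c + ((- a) * c + a * c) ≡⟨ cong (b * c +_) (sym (*-distribʳ-+ (- a) a c)) ⟩
      b * c + ((- a) + a) * c     ≡⟨ cong (λ z → b * c + z * c) (-‿inverseˡ a) ⟩
      b * c + 0# * c              ≡⟨ cong (b * c +_) (*-zeroˡ c) ⟩
      b * c + 0#                  ≡⟨ +-identityʳ (b * c) ⟩
      b * c                       ∎

  *-monoʳ-<-pos : ∀ {a b c} → 0# < c → a < b → c * a < c * b
  *-monoʳ-<-pos {a} {b} {c} 0<c a<b =
    subst₂ _<_ (*-comm a c) (*-comm b c) (*-monoˡ-<-pos 0<c a<b)

  0<⇒≢0 : ∀ {a} → 0# < a → ¬ (a ≡ 0#)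
  0<⇒≢0 0<a refl = <-irrefl 0# 0<a

  /-*-cancel : ∀ {x} → 0# < x → ∀ y → (y / x) * x ≡ y
  /-*-cancel {x} 0<x y = begin
    (y * (x ⁻¹)) * x ≡⟨ *-assoc y (x ⁻¹) x ⟩
    y * ((x ⁻¹) * x) ≡⟨ cong (y *_) (*-comm (x ⁻¹) x) ⟩
    y * (x * (x ⁻¹)) ≡⟨ cong (y *_) (⁻¹-inverseʳ x (0<⇒≢0 0<x)) ⟩
    y * 1#           ≡⟨ *-comm y 1# ⟩
    1# * y           ≡⟨ *-identityˡ y ⟩
    y                ∎

  <-/⇒*-< : ∀ {x} → 0# < x → ∀ {e y} → e < y / x → e * x < y
  <-/⇒*-< {x} 0<x {e} {y} e<y/x =
    subst (e * x <_) (/-*-cancel 0<x y) (*-monoˡ-<-pos 0<x e<y/x)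

  *-<⇒<-/ : ∀ {x} → 0# < x → ∀ {e y} → e * x < y → e < y / x
  *-<⇒<-/ {x} 0<x {e} {y} ex<y with <-trichotomy e (y / x)
  ... | inj₁ e<y/x        = e<y/x
  ... | inj₂ (inj₁ refl)  = ⊥-elim (<-irrefl y (subst (_< y) (/-*-cancel 0<x y) ex<y))
  ... | inj₂ (inj₂ y/x<e) =
    ⊥-elim (<-irrefl y (<-trans (subst (_< e * x) (/-*-cancel 0<x y) (*-monoˡ-<-pos 0<x y/x<e)) ex<y))

  InducesOn-intro : ∀ {k p} {K : Carrier → Set k} {P : Carrier → Set p} {a : Carrier} →
    (∀ e → K e → (e < a → P e) × (P e → e < a)) → InducesOn F K a P
  InducesOn-intro {P = P} {a} P⇔<a e ke = P⇔<a e ke , a≤e⇒¬P , ¬P⇒a≤e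
    where
    a≤e⇒¬P : a ≤ e → ¬ P e
    a≤e⇒¬P (inj₁ a<e) Pe = <-irrefl a (<-trans a<e (proj₂ (P⇔<a e ke) Pe))
    a≤e⇒¬P (inj₂ refl) Pe = <-irrefl a (proj₂ (P⇔<a e ke) Pe)
    ¬P⇒a≤e : ¬ P e → a ≤ e
    ¬P⇒a≤e ¬Pe with <-trichotomy e a
    ... | inj₁ e<a         = ⊥-elim (¬Pe (proj₁ (P⇔<a e ke) e<a))
    ... | inj₂ (inj₁ e≡a)  = inj₂ (sym e≡a)
    ... | inj₂ (inj₂ a<e)  = inj₁ a<e

module CutProperties {ℓ c : Level} (F : OrderedField ℓ) (C : Cut F c) where
  open OrderedField F
  open OrderedFieldProperties F
  open Cut C

  Lo-downward : ∀ {a b} → Lo a → b < a → Lo b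
  Lo-downward {a} {b} la b<a with cover b
  ... | inj₁ lb = lb
  ... | inj₂ hb = ⊥-elim (<-irrefl a (<-trans (ordered la hb) b<a))

  Lo-0# : Additive F C → Lo 0#
  Lo-0# (_ , (p , 0<p , lp)) = Lo-downward lp 0<p

  Lo-*-nonpos : Lo 0# → ∀ {e d} → e ≤ 0# → 0# < d → Lo (e * d)
  Lo-*-nonpos lo0 {e} {d} (inj₁ e<0) 0<d =
    Lo-downward lo0 (subst (e * d <_) (*-zeroˡ d) (*-monoˡ-<-pos 0<d e<0))
  Lo-*-nonpos lo0 {d = d} (inj₂ refl) _ = subst Lo (sym (*-zeroˡ d)) lo0

  LoMlt⇒<-/ : ∀ {x y e} → Lo x → 0# < x → Hi y → LoMlt F C e → e < y / x
  LoMlt⇒<-/ lx 0<x hy e∈mlt = *-<⇒<-/ 0<x (ordered (e∈mlt _ lx 0<x) hy)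

  module _ {k : Level} {K : Carrier → Set k} (KS : IsRealClosedSubfield F K) where
    open IsRealClosedSubfield KS

    <-/⇒LoMltIn : Lo 0# → ∀ {x y} → RealizesIn F K C x → RealizesIn F K C y →
      ∀ {e} → K e → e < y / x → LoMltIn F K C e
    <-/⇒LoMltIn lo0 {x} {y} (x-above , _) (_ , y-below) {e} ke e<y/x d kd ld 0<d
      with <-trichotomy e 0#
    ... | inj₁ e<0        = Lo-*-nonpos lo0 (inj₁ e<0) 0<d
    ... | inj₂ (inj₁ e≡0) = Lo-*-nonpos lo0 (inj₂ e≡0) 0<d
    ... | inj₂ (inj₂ 0<e) with cover (e * d)
    ...   | inj₁ l = l
    ...   | inj₂ h = ⊥-elim (<-irrefl y (<-trans (y-below (e * d) (*∈ ke kd) h) (<-trans ed<ex ex<y)))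
      where
      0<x : 0# < x
      0<x = x-above 0# 0∈ lo0
      ed<ex : e * d < e * x
      ed<ex = *-monoʳ-<-pos 0<e (x-above d kd ld)
      ex<y : e * x < y
      ex<y = <-/⇒*-< 0<x e<y/x

lemma2p10 : ∀ {ℓ k c : Level} (L : OrderedField ℓ) → IsRealClosed L →
    (K : OrderedField.Carrier L → Set k) → IsRealClosedSubfield L K →
    (C : Cut L c) → Additive L C →
    (∀ r → K r → (LoMlt L C r → LoMltIn L K C r) × (LoMltIn L K C r → LoMlt L C r)) →
    (x y : OrderedField.Carrier L) → RealizesIn L K C x → RealizesIn L K C y →
    Cut.Lo C x → Cut.Hi C y →
    InducesOn L K (OrderedField._/_ L y x) (LoMlt L C)
lemma2p10 L _ K KS C additive mlt-agree x y x-realizes y-realizes lx hy =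
  InducesOn-intro λ e ke →
    (λ e<y/x → proj₂ (mlt-agree e ke) (<-/⇒LoMltIn KS lo0 x-realizes y-realizes ke e<y/x)) ,
    LoMlt⇒<-/ lx 0<x hy
  where
  open OrderedField L using (0#; _<_)
  open OrderedFieldProperties L
  open CutProperties L C
  open IsRealClosedSubfield KS using (0∈)
  lo0 : Cut.Lo C 0#
  lo0 = Lo-0# additive
  0<x : 0# < x
  0<x = proj₁ x-realizes 0# 0∈ lo0
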